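{- Let $k,\ell,n$ be positive integers with $k\ge n$, and let $\mathcal F\subset 2^{[n]}$ be a full-support $k$-wise $\ell$-divisible family. Then $\mathcal F$ has an atom whose cardinality is divisible by $\ell$.
   Context: Full support: $\bigcup_{F\in\mathcal F}F=[n]$. $k$-wise $\ell$-divisible: $|A_1\cap\cdots\cap A_k|$ divisible by $\ell$ for all (not necessarily distinct) $A_1,\dots,A_k\in\mathcal F$. An atom of $\mathcal F$ is a non-empty subset $A$ of $[n]$ such that (i) for every $F\in\mathcal F$, either $A\subset F$ or $A\cap F=\varnothing$, and (ii) for every $B\supsetneq A$ there is $F\in\mathcal F$ with $\varnothing\subsetneq F\cap B\subsetneq B$. -}

module Defs where

open import Data.Nat using (ℕ)
open import Data.Nat.Divisibility using (_∣_)
open import Data.Fin using (Fin)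
open import Data.Fin.Subset using (Subset; _⊆_; _⊂_; _∩_; ⋃; ⋂; ⊤; ∣_∣; Nonempty; Empty)
open import Data.List using (List; tabulate)
open import Data.List.Membership.Propositional using (_∈_)
open import Data.Product using (Σ; ∃; _×_)
open import Data.Sum using (_⊎_)
open import Relation.Binary.PropositionalEquality using (_≡_)

-- A family of subsets of [n], represented as a list (duplicates irrelevant).
Family : ℕ → Set
Family n = List (Subset n)

FullSupport : ∀ {n} → Family n → Set
FullSupport {n} ℱ = ⋃ ℱ ≡ ⊤

KWiseDivisible : ∀ {n} → ℕ → ℕ → Family n → Set
KWiseDivisible {n} k ℓ ℱ =
  (A : Fin k → Subset n) → (∀ i → A i ∈ ℱ) → ℓ ∣ ∣ ⋂ (tabulate A) ∣

IsAtom : ∀ {n} → Family n → Subset n → Set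
IsAtom {n} ℱ A =
  Nonempty A
  × (∀ F → F ∈ ℱ → A ⊆ F ⊎ Empty (F ∩ A))
  × (∀ (B : Subset n) → A ⊂ B →
       Σ (Subset n) λ F → F ∈ ℱ × Nonempty (F ∩ B) × (F ∩ B) ⊂ B)

{-# OPTIONS --safe #-}
-- Let closure x be the intersection of all members of ℱ containing x. Each z ∉ closure x
-- is excluded by one such member, so closure x is the intersection of n ≤ k members
-- (repetitions allowed) and ℓ divides its size. If |closure x| is minimal, then
-- closure y = closure x for every y ∈ closure x; hence a member meeting closure x
-- contains x and therefore all of closure x, so closure x is an atom.
module Submission where

open import Defs
open import Data.Nat using (ℕ; _≤_; NonZero; suc)
open import Data.Nat.Properties using (<⇒≱)
open import Data.Nat.DivMod using (_mod_; _%_; m<n⇒m%n≡m)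
open import Data.Nat.Divisibility using (_∣_)
open import Data.Fin using (Fin; zero; toℕ; inject≤)
open import Data.Fin.Properties using (toℕ-injective; toℕ<n; toℕ-fromℕ<; toℕ-inject≤)
open import Data.Fin.Subset using (Subset; ∣_∣; _∈_; _∉_; _⊆_; _⊂_; _∩_; ⋃; ⋂; Nonempty; Empty)
open import Data.Fin.Subset.Properties
  using (_∈?_; ∈⊤; ∉⊥; x∈p∪q⁻; x∈p∩q⁺; x∈p∩q⁻; ⊆-antisym; p⊂q⇒∣p∣<∣q∣)
open import Data.List using (List; []; _∷_; tabulate; filter; allFin)
open import Data.List.Extrema.Nat using (argmin; f[argmin]≤f[xs])
open import Data.List.Membership.Propositional using (find) renaming (_∈_ to _∈ₗ_)
open import Data.List.Membership.Propositional.Properties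
  using (∈-filter⁺; ∈-filter⁻; ∈-allFin)
open import Data.List.Relation.Unary.All as All using (All; []; _∷_)
open import Data.List.Relation.Unary.All.Properties using (tabulate⁺; tabulate⁻; ¬All⇒Any¬)
open import Data.List.Relation.Unary.Any using (Any; here; there)
open import Data.Product using (Σ; ∃; _×_; _,_; proj₁; proj₂)
open import Data.Sum using (_⊎_; inj₁; inj₂; [_,_]′)
open import Function using (_∘_)
open import Function.Definitions using (StrictlySurjective)
open import Relation.Nullary using (yes; no; contradiction)
open import Relation.Binary.PropositionalEquality
  using (_≡_; sym; trans; cong; subst; module ≡-Reasoning)

argmin-Fin : ∀ {n} (f : Fin n → ℕ) → Fin n → Σ (Fin n) λ x → ∀ y → f x ≤ f y
argmin-Fin {n} f x₀ =
  argmin f x₀ (allFin n) , λ y → All.lookup (f[argmin]≤f[xs] x₀ (allFin n)) (∈-allFin y)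

mod-surjective : ∀ {m n} .{{_ : NonZero n}} → n ≤ m →
                 StrictlySurjective _≡_ (λ (i : Fin m) → toℕ i mod n)
mod-surjective {n = n} n≤m z = inject≤ z n≤m , toℕ-injective (begin
  toℕ (toℕ (inject≤ z n≤m) mod n)  ≡⟨ toℕ-fromℕ< _ ⟩
  toℕ (inject≤ z n≤m) % n          ≡⟨ cong (_% n) (toℕ-inject≤ z n≤m) ⟩
  toℕ z % n                        ≡⟨ m<n⇒m%n≡m (toℕ<n z) ⟩
  toℕ z                            ∎)
  where open ≡-Reasoning

∈⋂⁺ : ∀ {n} {x : Fin n} {ps : List (Subset n)} → All (x ∈_) ps → x ∈ ⋂ ps
∈⋂⁺ []           = ∈⊤
∈⋂⁺ (x∈p ∷ x∈ps) = x∈p∩q⁺ (x∈p , ∈⋂⁺ x∈ps)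

∈⋂⁻ : ∀ {n} {x : Fin n} (ps : List (Subset n)) → x ∈ ⋂ ps → All (x ∈_) ps
∈⋂⁻ []       _     = []
∈⋂⁻ (p ∷ ps) x∈⋂ with x∈p∩q⁻ p (⋂ ps) x∈⋂
... | x∈p , x∈⋂ps = x∈p ∷ ∈⋂⁻ ps x∈⋂ps

∈⋃⁻ : ∀ {n} {x : Fin n} (ps : List (Subset n)) → x ∈ ⋃ ps → Any (x ∈_) ps
∈⋃⁻ []       x∈⋃ = contradiction x∈⋃ ∉⊥
∈⋃⁻ (p ∷ ps) x∈⋃ = [ here , there ∘ ∈⋃⁻ ps ]′ (x∈p∪q⁻ p (⋃ ps) x∈⋃)

∈⋂-tabulate⁺ : ∀ {m n} {x : Fin n} {A : Fin m → Subset n} →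
               (∀ i → x ∈ A i) → x ∈ ⋂ (tabulate A)
∈⋂-tabulate⁺ = ∈⋂⁺ ∘ tabulate⁺

∈⋂-tabulate⁻ : ∀ {m n} {x : Fin n} (A : Fin m → Subset n) →
               x ∈ ⋂ (tabulate A) → ∀ i → x ∈ A i
∈⋂-tabulate⁻ A = tabulate⁻ ∘ ∈⋂⁻ (tabulate A)

⋂-tabulate-∘-surjective : ∀ {k m n} (A : Fin m → Subset n) {r : Fin k → Fin m} →
                          StrictlySurjective _≡_ r → ⋂ (tabulate (A ∘ r)) ≡ ⋂ (tabulate A)
⋂-tabulate-∘-surjective A {r} r-surj = ⊆-antisym ⋂A∘r⊆⋂A ⋂A⊆⋂A∘r
  where
  ⋂A∘r⊆⋂A : ⋂ (tabulate (A ∘ r)) ⊆ ⋂ (tabulate A)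
  ⋂A∘r⊆⋂A {x} x∈ = ∈⋂-tabulate⁺ λ j → let i , ri≡j = r-surj j in
    subst (λ j → x ∈ A j) ri≡j (∈⋂-tabulate⁻ (A ∘ r) x∈ i)

  ⋂A⊆⋂A∘r : ⋂ (tabulate A) ⊆ ⋂ (tabulate (A ∘ r))
  ⋂A⊆⋂A∘r x∈ = ∈⋂-tabulate⁺ (∈⋂-tabulate⁻ A x∈ ∘ r)

module _ {n} (ℱ : Family n) where

  closure : Fin n → Subset n
  closure x = ⋂ (filter (x ∈?_) ℱ)

  closure-⊆ : ∀ {x F} → F ∈ₗ ℱ → x ∈ F → closure x ⊆ F
  closure-⊆ {x} F∈ℱ x∈F z∈ =
    All.lookup (∈⋂⁻ (filter (x ∈?_) ℱ) z∈) (∈-filter⁺ (x ∈?_) F∈ℱ x∈F)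

  ∈-closure⁺ : ∀ {x z} → (∀ {F} → F ∈ₗ ℱ → x ∈ F → z ∈ F) → z ∈ closure x
  ∈-closure⁺ {x} z∈ℱ[x] =
    ∈⋂⁺ (All.tabulate λ F∈ → let F∈ℱ , x∈F = ∈-filter⁻ (x ∈?_) F∈ in z∈ℱ[x] F∈ℱ x∈F)

  x∈closure[x] : ∀ x → x ∈ closure x
  x∈closure[x] x = ∈-closure⁺ λ _ x∈F → x∈F

  ∉-closure⁻ : ∀ {x z} → z ∉ closure x → ∃ λ F → F ∈ₗ ℱ × x ∈ F × z ∉ F
  ∉-closure⁻ {x} {z} z∉ with find (¬All⇒Any¬ (z ∈?_) _ (z∉ ∘ ∈⋂⁺))
  ... | F , F∈ , z∉F with ∈-filter⁻ (x ∈?_) F∈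
  ...   | F∈ℱ , x∈F = F , F∈ℱ , x∈F , z∉F

  closure-mono : ∀ {x y} → y ∈ closure x → closure y ⊆ closure x
  closure-mono y∈ z∈ = ∈-closure⁺ λ F∈ℱ x∈F → closure-⊆ F∈ℱ (closure-⊆ F∈ℱ x∈F y∈) z∈

  module _ {x} (minimal : ∀ y → ∣ closure x ∣ ≤ ∣ closure y ∣) where

    minimal-closure-sym : ∀ {y} → y ∈ closure x → x ∈ closure y
    minimal-closure-sym {y} y∈ with x ∈? closure y
    ... | yes x∈ = x∈
    ... | no  x∉ = contradiction (minimal y)
                     (<⇒≱ (p⊂q⇒∣p∣<∣q∣ (closure-mono y∈ , x , x∈closure[x] x , x∉)))

    minimal-closure-isAtom : IsAtom ℱ (closure x)
    minimal-closure-isAtom = (x , x∈closure[x] x) , inside-or-disjoint , separated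
      where
      inside-or-disjoint : ∀ F → F ∈ₗ ℱ → closure x ⊆ F ⊎ Empty (F ∩ closure x)
      inside-or-disjoint F F∈ℱ with x ∈? F
      ... | yes x∈F = inj₁ (closure-⊆ F∈ℱ x∈F)
      ... | no  x∉F = inj₂ λ (y , y∈F∩) → let y∈F , y∈ = x∈p∩q⁻ F (closure x) y∈F∩ in
                        x∉F (closure-⊆ F∈ℱ y∈F (minimal-closure-sym y∈))

      separated : ∀ B → closure x ⊂ B →
                  Σ (Subset n) λ F → F ∈ₗ ℱ × Nonempty (F ∩ B) × (F ∩ B) ⊂ B
      separated B (⊆B , y , y∈B , y∉) with ∉-closure⁻ y∉
      ... | F , F∈ℱ , x∈F , y∉F =
        F , F∈ℱ , (x , x∈p∩q⁺ (x∈F , ⊆B (x∈closure[x] x))) ,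
        (proj₂ ∘ x∈p∩q⁻ F B) , y , y∈B , y∉F ∘ proj₁ ∘ x∈p∩q⁻ F B

  module _ (full : FullSupport ℱ) where

    separator : (x z : Fin n) →
                Σ (Subset n) λ F → F ∈ₗ ℱ × x ∈ F × (z ∉ closure x → z ∉ F)
    separator x z with z ∈? closure x
    ... | no z∉ = let F , F∈ℱ , x∈F , z∉F = ∉-closure⁻ z∉ in F , F∈ℱ , x∈F , λ _ → z∉F
    ... | yes z∈ with find (∈⋃⁻ ℱ (subst (x ∈_) (sym full) ∈⊤))
    ...   | F , F∈ℱ , x∈F = F , F∈ℱ , x∈F , contradiction z∈

    ⋂-separators≡closure : ∀ x → ⋂ (tabulate (proj₁ ∘ separator x)) ≡ closure x
    ⋂-separators≡closure x = ⊆-antisym ⋂⊆closure closure⊆⋂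
      where
      ⋂⊆closure : ⋂ (tabulate (proj₁ ∘ separator x)) ⊆ closure x
      ⋂⊆closure {z} z∈ with z ∈? closure x
      ... | yes z∈closure = z∈closure
      ... | no  z∉closure = let _ , _ , _ , z∉F = separator x z in
                            contradiction (∈⋂-tabulate⁻ _ z∈ z) (z∉F z∉closure)

      closure⊆⋂ : closure x ⊆ ⋂ (tabulate (proj₁ ∘ separator x))
      closure⊆⋂ z∈ = ∈⋂-tabulate⁺ λ z′ → let _ , F∈ℱ , x∈F , _ = separator x z′ in
                                          closure-⊆ F∈ℱ x∈F z∈

    closure≡⋂-of-k-members : ∀ {k} .{{_ : NonZero n}} → n ≤ k → ∀ x →
                             Σ (Fin k → Subset n) λ A →
                               (∀ i → A i ∈ₗ ℱ) × ⋂ (tabulate A) ≡ closure x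
    closure≡⋂-of-k-members {k} n≤k x =
      proj₁ ∘ separator x ∘ reduce , proj₁ ∘ proj₂ ∘ separator x ∘ reduce ,
      trans (⋂-tabulate-∘-surjective (proj₁ ∘ separator x) (mod-surjective n≤k))
            (⋂-separators≡closure x)
      where
      reduce : Fin k → Fin n
      reduce i = toℕ i mod n

lemma4p6 : (k ℓ n : ℕ) → NonZero k → NonZero ℓ → NonZero n → n ≤ k →
    (ℱ : Family n) → FullSupport ℱ → KWiseDivisible k ℓ ℱ →
    Σ (Subset n) λ A → IsAtom ℱ A × ℓ ∣ ∣ A ∣
lemma4p6 _ _ 0       _ _ () _ _ _ _
lemma4p6 k ℓ (suc m) _ _ _ n≤k ℱ full k-wise-div =
  let x , minimal           = argmin-Fin (∣_∣ ∘ closure ℱ) zero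
      A , A∈ℱ , ⋂A≡closure = closure≡⋂-of-k-members ℱ full n≤k x
  in  closure ℱ x , minimal-closure-isAtom ℱ minimal ,
      subst (ℓ ∣_) (cong ∣_∣ ⋂A≡closure) (k-wise-div A A∈ℱ)
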